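{- Let $m>n\geq1$ be coprime integers. Define the polynomials $$\mathcal{A}_{\frac{m}{n}}(q)=q\,\mathcal{N}_{\frac{m}{n}}(q)\mathcal{N}_{\frac{n}{m}}(q)+\mathcal{D}_{\frac{m}{n}}(q)\mathcal{D}_{\frac{n}{m}}(q),$$ $$\mathcal{B}_{\frac{m}{n}}(q)=\mathcal{N}_{\frac{m}{n}}(q)\mathcal{D}_{\frac{n}{m}}(q)-\mathcal{D}_{\frac{m}{n}}(q)\mathcal{N}_{\frac{n}{m}}(q),$$ $$\mathcal{C}_{\frac{m}{n}}(q)=q\,\mathcal{N}_{\frac{m}{n}}(q)^2+\mathcal{D}_{\frac{m}{n}}(q)^2.$$ Then $$\mathcal{A}_{\frac{m}{n}}(q)^2+q\,\mathcal{B}_{\frac{m}{n}}(q)^2=\mathcal{C}_{\frac{m}{n}}(q)\,\mathcal{C}^*_{\frac{m}{n}}(q),$$ where $\mathcal{C}^*_{\frac{m}{n}}(q):=q^{\deg(\mathcal{C}_{\frac{m}{n}})}\mathcal{C}_{\frac{m}{n}}(q^{ -1})$.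
   Context: $q$-rationals: for every rational $x$ the $q$-rational $[x]_q$ is the rational function of $q$ uniquely determined by $[0]_q=0$ and the rules $[x+1]_q=q[x]_q+1$ and $[-1/x]_q=-1/(q[x]_q)$. For a positive rational $x$, $\mathcal{N}_x(q)$ and $\mathcal{D}_x(q)$ denote the coprime polynomials in $\mathbb{Z}[q]$ with $[x]_q=\mathcal{N}_x(q)/\mathcal{D}_x(q)$ and $\mathcal{D}_x(0)=1$ (e.g. $[\frac32]_q=\frac{1+q+q^2}{1+q}$, $[\frac23]_q=\frac{q+q^2}{1+q+q^2}$). -}

module Defs where

open import Data.Nat as ℕ using (ℕ; zero; suc)
open import Data.Integer as ℤ using (ℤ; +_; -[1+_])
open import Data.Rational as ℚ using (ℚ; 0ℚ; 1ℚ; NonZero)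
open import Data.List using (List; []; _∷_; map; reverse; dropWhile)
open import Data.Product using (Σ; ∃; _×_; _,_)
open import Data.Sum using (_⊎_)
open import Relation.Nullary using (¬_)
open import Relation.Binary.PropositionalEquality using (_≡_)

-- Polynomials in ℤ[q], as coefficient lists, lowest degree first.
-- Trailing zeros are allowed; equality is coefficientwise.
Poly : Set
Poly = List ℤ

coeff : Poly → ℕ → ℤ
coeff []      _       = + 0
coeff (a ∷ p) zero    = a
coeff (a ∷ p) (suc k) = coeff p k

infix 4 _≈P_
_≈P_ : Poly → Poly → Set
p ≈P r = ∀ k → coeff p k ≡ coeff r k

0P : Poly
0P = []

1P : Poly
1P = + 1 ∷ []

qP : Poly
qP = + 0 ∷ + 1 ∷ []

infixl 6 _+P_
_+P_ : Poly → Poly → Poly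
[]      +P r       = r
(a ∷ p) +P []      = a ∷ p
(a ∷ p) +P (b ∷ r) = (a ℤ.+ b) ∷ (p +P r)

-P_ : Poly → Poly
-P p = map ℤ.-_ p

infixl 6 _-P_
_-P_ : Poly → Poly → Poly
p -P r = p +P (-P r)

infixl 7 _*P_
_*P_ : Poly → Poly → Poly
[]      *P r = []
(a ∷ p) *P r = map (a ℤ.*_) r +P (+ 0 ∷ (p *P r))

_∣P_ : Poly → Poly → Set
d ∣P p = Σ Poly λ r → d *P r ≈P p

IsUnitP : Poly → Set
IsUnitP u = (u ≈P 1P) ⊎ (u ≈P (-[1+ 0 ] ∷ []))

CoprimeP : Poly → Poly → Set
CoprimeP p r = ∀ d → d ∣P p → d ∣P r → IsUnitP d

strip : Poly → Poly
strip p = reverse (dropWhile (λ a → a ℤ.≟ + 0) (reverse p))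

-- reciprocal polynomial  p*(q) = q^{deg p} p(q^{-1})
recip : Poly → Poly
recip p = reverse (strip p)

-- Rep x N D : "[x]_q = N/D" as rational functions, generated by the
-- defining rules  [0]_q = 0,  [x+1]_q = q[x]_q + 1,  [-1/x]_q = -1/(q[x]_q),
-- and closed under replacing N/D by an equal fraction (D ≠ 0 always).
data Rep : ℚ → Poly → Poly → Set where
  rep0   : Rep 0ℚ 0P 1P
  repSuc : ∀ {x N D} → Rep x N D → Rep (x ℚ.+ 1ℚ) (qP *P N +P D) D
  repInv : ∀ {x N D} .{{_ : NonZero x}} → Rep x N D → ¬ (N ≈P 0P) →
           Rep (ℚ.- (ℚ.1/ x)) (-P D) (qP *P N)
  repEq  : ∀ {x N D N′ D′} → Rep x N D → N *P D′ ≈P N′ *P D → ¬ (D′ ≈P 0P) →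
           Rep x N′ D′

-- (N , D) = (𝒩_x , 𝒟_x): coprime in ℤ[q], with 𝒟_x(0) = 1, and [x]_q = N/D
IsND : ℚ → Poly → Poly → Set
IsND x N D = Rep x N D × CoprimeP N D × coeff D 0 ≡ + 1

-- By the Brahmagupta–Fibonacci identity for the form q X² + Y², A² + q B² is the product of
-- C = q N² + D² for m/n and the same expression C′ for n/m, so it suffices that C′ = C*.
-- Along the subtractive Euclidean algorithm [x]_q is built from [0]_q by the steps
-- x ↦ x + 1 and x ↦ x/(1 + x), and swapping a/b with b/a swaps these two steps; hence
-- N_{n/m} = q^d D_{m/n}(q⁻¹) and D_{n/m} = q^d N_{m/n}(q⁻¹) for a common degree bound d, so
-- C′ = q^{2d+1} C(q⁻¹), and C has exact degree 2d + 1 because D_{n/m}(0) = 1.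
-- The reduced N, D of the statement are identified with those produced by the algorithm,
-- which satisfy N U + D V = q^k and D(0) = 1.
module Submission where

open import Defs
open import Algebra.Bundles using (CommutativeRing)
open import Data.Empty using (⊥-elim; ⊥-elim-irr)
open import Data.Integer as ℤ using (ℤ; +_; -[1+_])
import Data.Integer.Properties as ℤ
open import Data.Integer.Divisibility.Signed using (∣ᵤ⇒∣; ∣⇒∣ᵤ; ∣m+n∣n⇒∣m)
open import Data.Integer.Tactic.RingSolver using () renaming (solve-∀ to solveℤ-∀)
open import Data.List using (List; []; _∷_; _++_; map; reverse; drop; dropWhile; applyUpTo; applyDownFrom)
import Data.List.Properties as List
open import Data.List.Relation.Unary.All using (All; []; _∷_)
open import Data.Maybe using (Maybe; just; nothing)
open import Data.Nat as ℕ using (ℕ; zero; suc; _+_; _∸_; _<_; _≤_; _≤?_; z≤n; s≤s; z<s; >-nonZero)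
import Data.Nat.Properties as ℕ
open import Data.Nat.Properties using (≤-trans; <⇒≤)
open import Data.Nat.Coprimality as Coprimality using (Coprime)
open import Data.Product using (Σ; ∃; _×_; _,_; proj₁; proj₂)
open import Data.Rational as ℚ using (ℚ; mkℚ; ↥_; ↧_; ↧ₙ_; 1ℚ; _/_)
import Data.Rational.Properties as ℚ
open import Data.Sum using (_⊎_; inj₁; inj₂)
open import Function using (_∘_)
open import Relation.Binary.Definitions using (tri<; tri≈; tri>)
open import Relation.Binary.PropositionalEquality
import Relation.Binary.Reasoning.Setoid
open import Relation.Nullary using (¬_; Dec; yes; no)
open import Tactic.RingSolver using (solve-∀)
open import Tactic.RingSolver.Core.AlmostCommutativeRing using (AlmostCommutativeRing; fromCommutativeRing)

-- The ring ℤ[q]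

module _ where
  open ≡-Reasoning

  coeff-+P : ∀ p r k → coeff (p +P r) k ≡ coeff p k ℤ.+ coeff r k
  coeff-+P []      r       k       = sym (ℤ.+-identityˡ _)
  coeff-+P (a ∷ p) []      k       = sym (ℤ.+-identityʳ _)
  coeff-+P (a ∷ p) (b ∷ r) zero    = refl
  coeff-+P (a ∷ p) (b ∷ r) (suc k) = coeff-+P p r k

  coeff--P : ∀ p k → coeff (-P p) k ≡ ℤ.- coeff p k
  coeff--P []      k       = refl
  coeff--P (a ∷ p) zero    = refl
  coeff--P (a ∷ p) (suc k) = coeff--P p k

  coeff-map-* : ∀ a r k → coeff (map (a ℤ.*_) r) k ≡ a ℤ.* coeff r k
  coeff-map-* a []      k       = sym (ℤ.*-zeroʳ a)
  coeff-map-* a (b ∷ r) zero    = refl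
  coeff-map-* a (b ∷ r) (suc k) = coeff-map-* a r k

  coeff-∷-*P : ∀ a p r k → coeff ((a ∷ p) *P r) k ≡ a ℤ.* coeff r k ℤ.+ coeff (+ 0 ∷ p *P r) k
  coeff-∷-*P a p r k = trans (coeff-+P (map (a ℤ.*_) r) _ k) (cong (ℤ._+ _) (coeff-map-* a r k))

  coeff-∷-*P-zero : ∀ a p r → coeff ((a ∷ p) *P r) 0 ≡ a ℤ.* coeff r 0
  coeff-∷-*P-zero a p r = trans (coeff-∷-*P a p r 0) (ℤ.+-identityʳ _)

  coeff-∷-*P-suc : ∀ a p r k →
    coeff ((a ∷ p) *P r) (suc k) ≡ a ℤ.* coeff r (suc k) ℤ.+ coeff (p *P r) k
  coeff-∷-*P-suc a p r k = coeff-∷-*P a p r (suc k)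

  coeff-*P-zero : ∀ p r → coeff (p *P r) 0 ≡ coeff p 0 ℤ.* coeff r 0
  coeff-*P-zero []      r = refl
  coeff-*P-zero (a ∷ p) r = coeff-∷-*P-zero a p r

  -- A record around _≈P_, so that both polynomials can be inferred from an equation.
  infix 4 _≋_
  record _≋_ (p r : Poly) : Set where
    constructor mk≋
    field ≋⇒≈P : p ≈P r
  open _≋_ public

  ≋-refl : ∀ {p} → p ≋ p
  ≋-refl = mk≋ λ _ → refl

  ≋-sym : ∀ {p r} → p ≋ r → r ≋ p
  ≋-sym (mk≋ e) = mk≋ λ k → sym (e k)

  ≋-trans : ∀ {p r s} → p ≋ r → r ≋ s → p ≋ s
  ≋-trans (mk≋ e) (mk≋ f) = mk≋ λ k → trans (e k) (f k)

  ≡⇒≋ : ∀ {p r} → p ≡ r → p ≋ r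
  ≡⇒≋ refl = ≋-refl

  ∷-cong : ∀ {a b p r} → a ≡ b → p ≋ r → a ∷ p ≋ b ∷ r
  ∷-cong a≡b (mk≋ e) = mk≋ λ { zero → a≡b ; (suc k) → e k }

  +P-cong : ∀ {p p′ r r′} → p ≋ p′ → r ≋ r′ → p +P r ≋ p′ +P r′
  +P-cong {p} {p′} {r} {r′} (mk≋ e) (mk≋ f) = mk≋ λ k → begin
    coeff (p +P r) k            ≡⟨ coeff-+P p r k ⟩
    coeff p k ℤ.+ coeff r k     ≡⟨ cong₂ ℤ._+_ (e k) (f k) ⟩
    coeff p′ k ℤ.+ coeff r′ k   ≡⟨ coeff-+P p′ r′ k ⟨
    coeff (p′ +P r′) k          ∎

  -P-cong : ∀ {p p′} → p ≋ p′ → -P p ≋ -P p′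
  -P-cong {p} {p′} (mk≋ e) =
    mk≋ λ k → trans (coeff--P p k) (trans (cong ℤ.-_ (e k)) (sym (coeff--P p′ k)))

  +P-comm : ∀ p r → p +P r ≋ r +P p
  +P-comm p r = mk≋ λ k →
    trans (coeff-+P p r k) (trans (ℤ.+-comm (coeff p k) _) (sym (coeff-+P r p k)))

  +P-assoc : ∀ p r s → (p +P r) +P s ≋ p +P (r +P s)
  +P-assoc p r s = mk≋ λ k → begin
    coeff ((p +P r) +P s) k                   ≡⟨ coeff-+P (p +P r) s k ⟩
    coeff (p +P r) k ℤ.+ coeff s k            ≡⟨ cong (ℤ._+ _) (coeff-+P p r k) ⟩
    coeff p k ℤ.+ coeff r k ℤ.+ coeff s k     ≡⟨ ℤ.+-assoc (coeff p k) _ _ ⟩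
    coeff p k ℤ.+ (coeff r k ℤ.+ coeff s k)   ≡⟨ cong₂ ℤ._+_ (refl {x = coeff p k}) (coeff-+P r s k) ⟨
    coeff p k ℤ.+ coeff (r +P s) k            ≡⟨ coeff-+P p (r +P s) k ⟨
    coeff (p +P (r +P s)) k                   ∎

  +P-identityʳ : ∀ p → p +P 0P ≋ p
  +P-identityʳ []      = ≋-refl
  +P-identityʳ (a ∷ p) = ≋-refl

  -P-inverseˡ : ∀ p → -P p +P p ≋ 0P
  -P-inverseˡ p = mk≋ λ k → trans (coeff-+P (-P p) p k)
    (trans (cong (ℤ._+ coeff p k) (coeff--P p k)) (ℤ.+-inverseˡ (coeff p k)))

  -P-inverseʳ : ∀ p → p +P -P p ≋ 0P
  -P-inverseʳ p = ≋-trans (+P-comm p (-P p)) (-P-inverseˡ p)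

  *P-congˡ : ∀ p {r r′} → r ≈P r′ → p *P r ≈P p *P r′
  *P-congˡ []      e k       = refl
  *P-congˡ (a ∷ p) {r} {r′} e zero = begin
    coeff ((a ∷ p) *P r) 0    ≡⟨ coeff-∷-*P-zero a p r ⟩
    a ℤ.* coeff r 0           ≡⟨ cong (a ℤ.*_) (e 0) ⟩
    a ℤ.* coeff r′ 0          ≡⟨ coeff-∷-*P-zero a p r′ ⟨
    coeff ((a ∷ p) *P r′) 0   ∎
  *P-congˡ (a ∷ p) {r} {r′} e (suc k) = begin
    coeff ((a ∷ p) *P r) (suc k)                     ≡⟨ coeff-∷-*P-suc a p r k ⟩
    a ℤ.* coeff r (suc k) ℤ.+ coeff (p *P r) k       ≡⟨ cong₂ ℤ._+_ (cong (a ℤ.*_) (e (suc k))) (*P-congˡ p e k) ⟩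
    a ℤ.* coeff r′ (suc k) ℤ.+ coeff (p *P r′) k     ≡⟨ coeff-∷-*P-suc a p r′ k ⟨
    coeff ((a ∷ p) *P r′) (suc k)                    ∎

  ≈0P⇒*P≈0P : ∀ p r → p ≈P 0P → p *P r ≈P 0P
  ≈0P⇒*P≈0P []      r e k       = refl
  ≈0P⇒*P≈0P (a ∷ p) r e zero    = begin
    coeff ((a ∷ p) *P r) 0     ≡⟨ coeff-∷-*P-zero a p r ⟩
    a ℤ.* coeff r 0            ≡⟨ cong (ℤ._* _) (e 0) ⟩
    + 0 ℤ.* coeff r 0          ≡⟨ ℤ.*-zeroˡ (coeff r 0) ⟩
    + 0                        ∎
  ≈0P⇒*P≈0P (a ∷ p) r e (suc k) = begin
    coeff ((a ∷ p) *P r) (suc k)                   ≡⟨ coeff-∷-*P-suc a p r k ⟩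
    a ℤ.* coeff r (suc k) ℤ.+ coeff (p *P r) k     ≡⟨ cong₂ ℤ._+_ (cong (ℤ._* _) (e 0)) (≈0P⇒*P≈0P p r (e ∘ suc) k) ⟩
    + 0 ℤ.* coeff r (suc k) ℤ.+ + 0                ≡⟨ cong (ℤ._+ + 0) (ℤ.*-zeroˡ (coeff r (suc k))) ⟩
    + 0                                            ∎

  *P-congʳ : ∀ {p p′} r → p ≈P p′ → p *P r ≈P p′ *P r
  *P-congʳ {[]}    {p′}     r e k = sym (≈0P⇒*P≈0P p′ r (sym ∘ e) k)
  *P-congʳ {a ∷ p} {[]}     r e k = ≈0P⇒*P≈0P (a ∷ p) r e k
  *P-congʳ {a ∷ p} {a′ ∷ p′} r e zero = begin
    coeff ((a ∷ p) *P r) 0       ≡⟨ coeff-∷-*P-zero a p r ⟩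
    a ℤ.* coeff r 0              ≡⟨ cong (ℤ._* _) (e 0) ⟩
    a′ ℤ.* coeff r 0             ≡⟨ coeff-∷-*P-zero a′ p′ r ⟨
    coeff ((a′ ∷ p′) *P r) 0     ∎
  *P-congʳ {a ∷ p} {a′ ∷ p′} r e (suc k) = begin
    coeff ((a ∷ p) *P r) (suc k)
      ≡⟨ coeff-∷-*P-suc a p r k ⟩
    a ℤ.* coeff r (suc k) ℤ.+ coeff (p *P r) k
      ≡⟨ cong₂ ℤ._+_ (cong (ℤ._* _) (e 0)) (*P-congʳ {p} {p′} r (e ∘ suc) k) ⟩
    a′ ℤ.* coeff r (suc k) ℤ.+ coeff (p′ *P r) k
      ≡⟨ coeff-∷-*P-suc a′ p′ r k ⟨
    coeff ((a′ ∷ p′) *P r) (suc k) ∎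

  *P-cong : ∀ {p p′ r r′} → p ≋ p′ → r ≋ r′ → p *P r ≋ p′ *P r′
  *P-cong {p} {p′} {r} (mk≋ e) (mk≋ f) = mk≋ λ k → trans (*P-congʳ {p} {p′} r e k) (*P-congˡ p′ f k)

  *P-distribˡ : ∀ p r s → p *P (r +P s) ≋ p *P r +P p *P s
  *P-distribˡ []      r s = ≋-refl
  *P-distribˡ (a ∷ p) r s = mk≋ λ
    { zero → begin
        coeff ((a ∷ p) *P (r +P s)) 0
          ≡⟨ coeff-∷-*P-zero a p (r +P s) ⟩
        a ℤ.* coeff (r +P s) 0
          ≡⟨ cong (a ℤ.*_) (coeff-+P r s 0) ⟩
        a ℤ.* (coeff r 0 ℤ.+ coeff s 0)
          ≡⟨ ℤ.*-distribˡ-+ a _ _ ⟩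
        a ℤ.* coeff r 0 ℤ.+ a ℤ.* coeff s 0
          ≡⟨ cong₂ ℤ._+_ (coeff-∷-*P-zero a p r) (coeff-∷-*P-zero a p s) ⟨
        coeff ((a ∷ p) *P r) 0 ℤ.+ coeff ((a ∷ p) *P s) 0
          ≡⟨ coeff-+P ((a ∷ p) *P r) _ 0 ⟨
        coeff ((a ∷ p) *P r +P (a ∷ p) *P s) 0 ∎
    ; (suc k) → begin
        coeff ((a ∷ p) *P (r +P s)) (suc k)
          ≡⟨ coeff-∷-*P-suc a p (r +P s) k ⟩
        a ℤ.* coeff (r +P s) (suc k) ℤ.+ coeff (p *P (r +P s)) k
          ≡⟨ cong₂ ℤ._+_ (cong (a ℤ.*_) (coeff-+P r s (suc k)))
                         (trans (≋⇒≈P (*P-distribˡ p r s) k) (coeff-+P (p *P r) _ k)) ⟩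
        a ℤ.* (coeff r (suc k) ℤ.+ coeff s (suc k)) ℤ.+ (coeff (p *P r) k ℤ.+ coeff (p *P s) k)
          ≡⟨ interchange a _ _ _ _ ⟩
        (a ℤ.* coeff r (suc k) ℤ.+ coeff (p *P r) k) ℤ.+ (a ℤ.* coeff s (suc k) ℤ.+ coeff (p *P s) k)
          ≡⟨ cong₂ ℤ._+_ (coeff-∷-*P-suc a p r k) (coeff-∷-*P-suc a p s k) ⟨
        coeff ((a ∷ p) *P r) (suc k) ℤ.+ coeff ((a ∷ p) *P s) (suc k)
          ≡⟨ coeff-+P ((a ∷ p) *P r) _ (suc k) ⟨
        coeff ((a ∷ p) *P r +P (a ∷ p) *P s) (suc k) ∎ }
    where
    interchange : ∀ a x y u v → a ℤ.* (x ℤ.+ y) ℤ.+ (u ℤ.+ v) ≡ (a ℤ.* x ℤ.+ u) ℤ.+ (a ℤ.* y ℤ.+ v)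
    interchange = solveℤ-∀

  *P-zeroʳ : ∀ p → p *P 0P ≋ 0P
  *P-zeroʳ []      = ≋-refl
  *P-zeroʳ (a ∷ p) = mk≋ λ { zero → refl ; (suc k) → ≋⇒≈P (*P-zeroʳ p) k }

  *P-∷ʳ : ∀ p b r → p *P (b ∷ r) ≋ map (b ℤ.*_) p +P (+ 0 ∷ p *P r)
  *P-∷ʳ []      b r = mk≋ λ { zero → refl ; (suc k) → refl }
  *P-∷ʳ (a ∷ p) b r = mk≋ λ
    { zero → trans (coeff-∷-*P-zero a p (b ∷ r)) (trans (ℤ.*-comm a b) (sym (ℤ.+-identityʳ _)))
    ; (suc k) → begin
        coeff ((a ∷ p) *P (b ∷ r)) (suc k)
          ≡⟨ coeff-∷-*P-suc a p (b ∷ r) k ⟩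
        a ℤ.* coeff r k ℤ.+ coeff (p *P (b ∷ r)) k
          ≡⟨ cong (λ z → a ℤ.* coeff r k ℤ.+ z) (trans (≋⇒≈P (*P-∷ʳ p b r) k) (coeff-+P (map (b ℤ.*_) p) _ k)) ⟩
        a ℤ.* coeff r k ℤ.+ (coeff (map (b ℤ.*_) p) k ℤ.+ coeff (+ 0 ∷ p *P r) k)
          ≡⟨ swap (a ℤ.* coeff r k) (coeff (map (b ℤ.*_) p) k) (coeff (+ 0 ∷ p *P r) k) ⟩
        coeff (map (b ℤ.*_) p) k ℤ.+ (a ℤ.* coeff r k ℤ.+ coeff (+ 0 ∷ p *P r) k)
          ≡⟨ cong (λ z → coeff (map (b ℤ.*_) p) k ℤ.+ z) (coeff-∷-*P a p r k) ⟨
        coeff (map (b ℤ.*_) p) k ℤ.+ coeff ((a ∷ p) *P r) k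
          ≡⟨ coeff-+P (map (b ℤ.*_) p) _ k ⟨
        coeff (map (b ℤ.*_) (a ∷ p) +P (+ 0 ∷ (a ∷ p) *P r)) (suc k) ∎ }
    where
    swap : ∀ x y z → x ℤ.+ (y ℤ.+ z) ≡ y ℤ.+ (x ℤ.+ z)
    swap = solveℤ-∀

  *P-comm : ∀ p r → p *P r ≋ r *P p
  *P-comm []      r = ≋-sym (*P-zeroʳ r)
  *P-comm (a ∷ p) r = ≋-trans (+P-cong ≋-refl (∷-cong refl (*P-comm p r))) (≋-sym (*P-∷ʳ r a p))

  *P-distribʳ : ∀ p r s → (r +P s) *P p ≋ r *P p +P s *P p
  *P-distribʳ p r s =
    ≋-trans (*P-comm (r +P s) p) (≋-trans (*P-distribˡ p r s) (+P-cong (*P-comm p r) (*P-comm p s)))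

  map-0* : ∀ s → map (+ 0 ℤ.*_) s ≋ 0P
  map-0* s = mk≋ λ k → trans (coeff-map-* (+ 0) s k) (ℤ.*-zeroˡ (coeff s k))

  0∷-*P : ∀ p s → (+ 0 ∷ p) *P s ≋ + 0 ∷ p *P s
  0∷-*P p s = +P-cong (map-0* s) ≋-refl

  map-*-*P : ∀ a r s → map (a ℤ.*_) r *P s ≋ map (a ℤ.*_) (r *P s)
  map-*-*P a []      s = ≋-refl
  map-*-*P a (b ∷ r) s = mk≋ λ
    { zero → begin
        coeff ((a ℤ.* b ∷ map (a ℤ.*_) r) *P s) 0     ≡⟨ coeff-∷-*P-zero (a ℤ.* b) (map (a ℤ.*_) r) s ⟩
        a ℤ.* b ℤ.* coeff s 0                          ≡⟨ ℤ.*-assoc a b _ ⟩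
        a ℤ.* (b ℤ.* coeff s 0)                        ≡⟨ cong (a ℤ.*_) (coeff-∷-*P-zero b r s) ⟨
        a ℤ.* coeff ((b ∷ r) *P s) 0                   ≡⟨ coeff-map-* a ((b ∷ r) *P s) 0 ⟨
        coeff (map (a ℤ.*_) ((b ∷ r) *P s)) 0          ∎
    ; (suc k) → begin
        coeff ((a ℤ.* b ∷ map (a ℤ.*_) r) *P s) (suc k)
          ≡⟨ coeff-∷-*P-suc (a ℤ.* b) (map (a ℤ.*_) r) s k ⟩
        a ℤ.* b ℤ.* coeff s (suc k) ℤ.+ coeff (map (a ℤ.*_) r *P s) k
          ≡⟨ cong (λ z → a ℤ.* b ℤ.* coeff s (suc k) ℤ.+ z)
                  (trans (≋⇒≈P (map-*-*P a r s) k) (coeff-map-* a (r *P s) k)) ⟩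
        a ℤ.* b ℤ.* coeff s (suc k) ℤ.+ a ℤ.* coeff (r *P s) k
          ≡⟨ factor a b _ _ ⟩
        a ℤ.* (b ℤ.* coeff s (suc k) ℤ.+ coeff (r *P s) k)
          ≡⟨ cong (a ℤ.*_) (coeff-∷-*P-suc b r s k) ⟨
        a ℤ.* coeff ((b ∷ r) *P s) (suc k)
          ≡⟨ coeff-map-* a ((b ∷ r) *P s) (suc k) ⟨
        coeff (map (a ℤ.*_) ((b ∷ r) *P s)) (suc k) ∎ }
    where
    factor : ∀ a b x y → a ℤ.* b ℤ.* x ℤ.+ a ℤ.* y ≡ a ℤ.* (b ℤ.* x ℤ.+ y)
    factor = solveℤ-∀

  *P-assoc : ∀ p r s → (p *P r) *P s ≋ p *P (r *P s)
  *P-assoc []      r s = ≋-refl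
  *P-assoc (a ∷ p) r s = ≋-trans (*P-distribʳ s (map (a ℤ.*_) r) (+ 0 ∷ p *P r))
    (+P-cong (map-*-*P a r s) (≋-trans (0∷-*P (p *P r) s) (∷-cong refl (*P-assoc p r s))))

  con : ℤ → Poly
  con a = a ∷ []

  con-*P : ∀ a p → con a *P p ≋ map (a ℤ.*_) p
  con-*P a p = mk≋ λ k → trans (coeff-+P (map (a ℤ.*_) p) _ k)
    (trans (cong (λ z → coeff (map (a ℤ.*_) p) k ℤ.+ z) (coeff-[0] k)) (ℤ.+-identityʳ _))
    where
    coeff-[0] : ∀ k → coeff (+ 0 ∷ []) k ≡ + 0
    coeff-[0] zero    = refl
    coeff-[0] (suc k) = refl

  *P-identityˡ : ∀ p → 1P *P p ≋ p
  *P-identityˡ p = ≋-trans (con-*P (+ 1) p) (mk≋ λ k → trans (coeff-map-* (+ 1) p k) (ℤ.*-identityˡ _))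

  *P-identityʳ : ∀ p → p *P 1P ≋ p
  *P-identityʳ p = ≋-trans (*P-comm p 1P) (*P-identityˡ p)

polyCommutativeRing : CommutativeRing _ _
polyCommutativeRing = record
  { Carrier = Poly
  ; _≈_ = _≋_
  ; _+_ = _+P_
  ; _*_ = _*P_
  ; -_ = -P_
  ; 0# = 0P
  ; 1# = 1P
  ; isCommutativeRing = record
    { isRing = record
      { +-isAbelianGroup = record
        { isGroup = record
          { isMonoid = record
            { isSemigroup = record
              { isMagma = record
                { isEquivalence = record { refl = ≋-refl ; sym = ≋-sym ; trans = ≋-trans }
                ; ∙-cong = +P-cong }
              ; assoc = +P-assoc }
            ; identity = (λ _ → ≋-refl) , +P-identityʳ }
          ; inverse = -P-inverseˡ , -P-inverseʳ
          ; ⁻¹-cong = -P-cong }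
        ; comm = +P-comm }
      ; *-cong = *P-cong
      ; *-assoc = *P-assoc
      ; *-identity = *P-identityˡ , *P-identityʳ
      ; distrib = *P-distribˡ , *P-distribʳ }
    ; *-comm = *P-comm }
  }

-- A partial zero test suffices: the ring solver only uses it to prune zero terms.
0P≟_ : ∀ p → Maybe (0P ≋ p)
0P≟ []        = just ≋-refl
0P≟ (+ 0 ∷ p) with 0P≟ p
... | just e  = just (mk≋ λ { zero → refl ; (suc k) → ≋⇒≈P e k })
... | nothing = nothing
0P≟ (_ ∷ p)   = nothing

polyRing : AlmostCommutativeRing _ _
polyRing = fromCommutativeRing polyCommutativeRing 0P≟_

qP*P≋0∷ : ∀ p → qP *P p ≋ + 0 ∷ p
qP*P≋0∷ p = ≋-trans (0∷-*P 1P p) (∷-cong refl (*P-identityˡ p))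

∷-horner : ∀ a p → a ∷ p ≋ con a +P qP *P p
∷-horner a p = ≋-sym (≋-trans (+P-cong (≋-refl {con a}) (qP*P≋0∷ p)) (∷-cong (ℤ.+-identityʳ a) ≋-refl))

q^_ : ℕ → Poly
q^ zero  = 1P
q^ suc k = qP *P q^ k

module ≋-Reasoning = Relation.Binary.Reasoning.Setoid (CommutativeRing.setoid polyCommutativeRing)

-- Degrees and reciprocal polynomials

Degree≤ : ℕ → Poly → Set
Degree≤ d p = ∀ k → d < k → coeff p k ≡ + 0

Degree≤-cong : ∀ {d p r} → p ≋ r → Degree≤ d p → Degree≤ d r
Degree≤-cong p≋r deg k d<k = trans (sym (≋⇒≈P p≋r k)) (deg k d<k)

Degree≤-mono : ∀ {d e p} → d ≤ e → Degree≤ d p → Degree≤ e p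
Degree≤-mono d≤e deg k e<k = deg k (ℕ.≤-<-trans d≤e e<k)

Degree≤-+P : ∀ {d p r} → Degree≤ d p → Degree≤ d r → Degree≤ d (p +P r)
Degree≤-+P {p = p} {r} degp degr k d<k = trans (coeff-+P p r k) (cong₂ ℤ._+_ (degp k d<k) (degr k d<k))

Degree≤-qP*P : ∀ {d p} → Degree≤ d p → Degree≤ (suc d) (qP *P p)
Degree≤-qP*P {p = p} deg = Degree≤-cong (≋-sym (qP*P≋0∷ p)) λ { (suc k) (s≤s d<k) → deg k d<k }

Degree≤-∷ : ∀ {d a p} → Degree≤ (suc d) (a ∷ p) → Degree≤ d p
Degree≤-∷ deg k d<k = deg (suc k) (s≤s d<k)

Degree≤-*P : ∀ d {e} p {r} → Degree≤ d p → Degree≤ e r → Degree≤ (d + e) (p *P r)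
Degree≤-*P d       []      degp degr k _   = refl
Degree≤-*P d {e} (a ∷ p) {r} degp degr k d+e<k = begin
  coeff ((a ∷ p) *P r) k                      ≡⟨ coeff-∷-*P a p r k ⟩
  a ℤ.* coeff r k ℤ.+ coeff (+ 0 ∷ p *P r) k  ≡⟨ cong₂ ℤ._+_ (cong (a ℤ.*_) (degr k e<k)) (shifted d k degp d+e<k) ⟩
  a ℤ.* + 0 ℤ.+ + 0                           ≡⟨ cong (ℤ._+ + 0) (ℤ.*-zeroʳ a) ⟩
  + 0                                         ∎
  where
  open ≡-Reasoning
  e<k = ℕ.≤-<-trans (ℕ.m≤n+m e d) d+e<k
  shifted : ∀ d k → Degree≤ d (a ∷ p) → d + e < k → coeff (+ 0 ∷ p *P r) k ≡ + 0
  shifted zero    (suc k) degp _           = ≈0P⇒*P≈0P p r (λ j → degp (suc j) (s≤s z≤n)) k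
  shifted (suc d) (suc k) degp (s≤s d+e<k) = Degree≤-*P d p (Degree≤-∷ degp) degr k d+e<k

-- q^d p(q⁻¹), for a polynomial p of degree at most d
recipAt : ℕ → Poly → Poly
recipAt d p = applyDownFrom (coeff p) (suc d)

coeff-drop : ∀ n p k → coeff (drop n p) k ≡ coeff p (n + k)
coeff-drop zero    p       k = refl
coeff-drop (suc n) []      k = refl
coeff-drop (suc n) (a ∷ p) k = coeff-drop n p k

≈0P⇒All≡0 : ∀ p → p ≈P 0P → All (_≡ + 0) p
≈0P⇒All≡0 []      _ = []
≈0P⇒All≡0 (a ∷ p) e = e 0 ∷ ≈0P⇒All≡0 p (e ∘ suc)

≢0⇒≡applyUpTo++drop : ∀ d p → coeff p d ≢ + 0 → p ≡ applyUpTo (coeff p) (suc d) ++ drop (suc d) p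
≢0⇒≡applyUpTo++drop d       []      p[d]≢0 = ⊥-elim (p[d]≢0 refl)
≢0⇒≡applyUpTo++drop zero    (a ∷ p) p[d]≢0 = refl
≢0⇒≡applyUpTo++drop (suc d) (a ∷ p) p[d]≢0 = cong (a ∷_) (≢0⇒≡applyUpTo++drop d p p[d]≢0)

dropZeros : List ℤ → List ℤ
dropZeros = dropWhile (ℤ._≟ + 0)

dropZeros-reverse-++ : ∀ {zs} → All (_≡ + 0) zs → ∀ ys → dropZeros (reverse zs ++ ys) ≡ dropZeros ys
dropZeros-reverse-++ []                    ys = refl
dropZeros-reverse-++ {_ ∷ zs} (refl ∷ zs≡0) ys = begin
  dropZeros (reverse (+ 0 ∷ zs) ++ ys)      ≡⟨ cong (λ l → dropZeros (l ++ ys)) (List.unfold-reverse (+ 0) zs) ⟩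
  dropZeros ((reverse zs ++ + 0 ∷ []) ++ ys) ≡⟨ cong dropZeros (List.++-assoc (reverse zs) (+ 0 ∷ []) ys) ⟩
  dropZeros (reverse zs ++ + 0 ∷ ys)         ≡⟨ dropZeros-reverse-++ zs≡0 (+ 0 ∷ ys) ⟩
  dropZeros ys                               ∎
  where open ≡-Reasoning

dropZeros-≢0 : ∀ {a} as → a ≢ + 0 → dropZeros (a ∷ as) ≡ a ∷ as
dropZeros-≢0 {a} as a≢0 with a ℤ.≟ + 0
... | yes a≡0 = ⊥-elim (a≢0 a≡0)
... | no  _   = refl

recip≡recipAt : ∀ d p → Degree≤ d p → coeff p d ≢ + 0 → recip p ≡ recipAt d p
recip≡recipAt d p deg p[d]≢0 = begin
  reverse (reverse (dropZeros (reverse p)))      ≡⟨ List.reverse-involutive _ ⟩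
  dropZeros (reverse p)                          ≡⟨ cong (dropZeros ∘ reverse) (≢0⇒≡applyUpTo++drop d p p[d]≢0) ⟩
  dropZeros (reverse (low ++ high))              ≡⟨ cong dropZeros (List.reverse-++ low high) ⟩
  dropZeros (reverse high ++ reverse low)        ≡⟨ dropZeros-reverse-++ high≡0 (reverse low) ⟩
  dropZeros (reverse low)                        ≡⟨ cong dropZeros (List.reverse-applyUpTo (coeff p) (suc d)) ⟩
  dropZeros (recipAt d p)                        ≡⟨ dropZeros-≢0 (applyDownFrom (coeff p) d) p[d]≢0 ⟩
  recipAt d p                                    ∎
  where
  open ≡-Reasoning
  low  = applyUpTo (coeff p) (suc d)
  high = drop (suc d) p
  high≡0 : All (_≡ + 0) high
  high≡0 = ≈0P⇒All≡0 high λ k → trans (coeff-drop (suc d) p k) (deg (suc d + k) (ℕ.m≤m+n (suc d) k))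

recipAt-cong : ∀ d {p r} → p ≋ r → recipAt d p ≡ recipAt d r
recipAt-cong zero    p≋r = cong (_∷ []) (≋⇒≈P p≋r 0)
recipAt-cong (suc d) p≋r = cong₂ _∷_ (≋⇒≈P p≋r (suc d)) (recipAt-cong d p≋r)

recipAt-+P : ∀ d p r → recipAt d (p +P r) ≡ recipAt d p +P recipAt d r
recipAt-+P zero    p r = cong (_∷ []) (coeff-+P p r 0)
recipAt-+P (suc d) p r = cong₂ _∷_ (coeff-+P p r (suc d)) (recipAt-+P d p r)

recipAt-map-* : ∀ d a p → recipAt d (map (a ℤ.*_) p) ≡ map (a ℤ.*_) (recipAt d p)
recipAt-map-* zero    a p = cong (_∷ []) (coeff-map-* a p 0)
recipAt-map-* (suc d) a p = cong₂ _∷_ (coeff-map-* a p (suc d)) (recipAt-map-* d a p)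

recipAt-con*P : ∀ d a p → recipAt d (con a *P p) ≋ con a *P recipAt d p
recipAt-con*P d a p = begin
  recipAt d (con a *P p)         ≡⟨ recipAt-cong d (con-*P a p) ⟩
  recipAt d (map (a ℤ.*_) p)     ≡⟨ recipAt-map-* d a p ⟩
  map (a ℤ.*_) (recipAt d p)     ≈⟨ con-*P a (recipAt d p) ⟨
  con a *P recipAt d p           ∎
  where open ≋-Reasoning

recipAt-0P : ∀ d → recipAt d 0P ≋ 0P
recipAt-0P zero    = mk≋ λ { zero → refl ; (suc k) → refl }
recipAt-0P (suc d) = mk≋ λ { zero → refl ; (suc k) → ≋⇒≈P (recipAt-0P d) k }

recipAt-suc : ∀ d p → Degree≤ d p → recipAt (suc d) p ≋ qP *P recipAt d p
recipAt-suc d p deg = ≋-trans (∷-cong (deg (suc d) ℕ.≤-refl) ≋-refl) (≋-sym (qP*P≋0∷ (recipAt d p)))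

recipAt-raise : ∀ j e r → Degree≤ e r → recipAt (j + e) r ≋ q^ j *P recipAt e r
recipAt-raise zero    e r deg = ≋-sym (*P-identityˡ (recipAt e r))
recipAt-raise (suc j) e r deg = begin
  recipAt (suc (j + e)) r             ≈⟨ recipAt-suc (j + e) r (Degree≤-mono {p = r} (ℕ.m≤n+m e j) deg) ⟩
  qP *P recipAt (j + e) r             ≈⟨ *P-cong (≋-refl {qP}) (recipAt-raise j e r deg) ⟩
  qP *P (q^ j *P recipAt e r)         ≈⟨ *P-assoc qP (q^ j) (recipAt e r) ⟨
  q^ suc j *P recipAt e r             ∎
  where open ≋-Reasoning

recipAt-0∷ : ∀ d p → recipAt (suc d) (+ 0 ∷ p) ≋ recipAt d p
recipAt-0∷ zero    p = mk≋ λ { zero → refl ; (suc zero) → refl ; (suc (suc k)) → refl }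
recipAt-0∷ (suc d) p = ∷-cong refl (recipAt-0∷ d p)

recipAt-qP*P : ∀ d p → recipAt (suc d) (qP *P p) ≋ recipAt d p
recipAt-qP*P d p = ≋-trans (≡⇒≋ (recipAt-cong (suc d) (qP*P≋0∷ p))) (recipAt-0∷ d p)

recipAt-∷ : ∀ d a p → recipAt (suc d) (a ∷ p) ≋ recipAt d p +P con a *P q^ suc d
recipAt-∷ zero a p = begin
  coeff p 0 ∷ a ∷ []
    ≈⟨ ∷-horner (coeff p 0) (con a) ⟩
  con (coeff p 0) +P qP *P con a
    ≈⟨ +P-cong (≋-refl {con (coeff p 0)}) (*P-comm qP (con a)) ⟩
  con (coeff p 0) +P con a *P qP
    ≈⟨ +P-cong (≋-refl {con (coeff p 0)}) (*P-cong (≋-refl {con a}) (*P-identityʳ qP)) ⟨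
  con (coeff p 0) +P con a *P q^ 1 ∎
  where open ≋-Reasoning
recipAt-∷ (suc d) a p = begin
  coeff p (suc d) ∷ recipAt (suc d) (a ∷ p)
    ≈⟨ ∷-horner (coeff p (suc d)) (recipAt (suc d) (a ∷ p)) ⟩
  con (coeff p (suc d)) +P qP *P recipAt (suc d) (a ∷ p)
    ≈⟨ +P-cong (≋-refl {con (coeff p (suc d))}) (*P-cong (≋-refl {qP}) (recipAt-∷ d a p)) ⟩
  con (coeff p (suc d)) +P qP *P (recipAt d p +P con a *P q^ suc d)
    ≈⟨ regroup (con (coeff p (suc d))) qP (recipAt d p) (con a) (q^ suc d) ⟩
  (con (coeff p (suc d)) +P qP *P recipAt d p) +P con a *P q^ suc (suc d)
    ≈⟨ +P-cong (∷-horner (coeff p (suc d)) (recipAt d p)) (≋-refl {con a *P q^ suc (suc d)}) ⟨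
  recipAt (suc d) p +P con a *P q^ suc (suc d) ∎
  where
  open ≋-Reasoning
  regroup : ∀ c q r a Q → c +P q *P (r +P a *P Q) ≋ (c +P q *P r) +P a *P (q *P Q)
  regroup = solve-∀ polyRing

Degree≤0⇒≋con : ∀ p → Degree≤ 0 p → p ≋ con (coeff p 0)
Degree≤0⇒≋con p deg = mk≋ λ { zero → refl ; (suc k) → deg (suc k) (s≤s z≤n) }

recipAt-*P : ∀ d e p r → Degree≤ d p → Degree≤ e r → recipAt (d + e) (p *P r) ≋ recipAt d p *P recipAt e r
recipAt-*P d e [] r degp degr =
  ≋-trans (recipAt-0P (d + e)) (≋-sym (*P-cong (recipAt-0P d) (≋-refl {recipAt e r})))
recipAt-*P zero e (a ∷ p) r degp degr = begin
  recipAt e ((a ∷ p) *P r)   ≡⟨ recipAt-cong e (*P-cong (Degree≤0⇒≋con (a ∷ p) degp) (≋-refl {r})) ⟩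
  recipAt e (con a *P r)     ≈⟨ recipAt-con*P e a r ⟩
  con a *P recipAt e r       ∎
  where open ≋-Reasoning
recipAt-*P (suc d) e (a ∷ p) r degp degr = begin
  recipAt (suc d + e) ((a ∷ p) *P r)
    ≡⟨ recipAt-cong (suc d + e) (*P-cong (∷-horner a p) (≋-refl {r})) ⟩
  recipAt (suc d + e) ((con a +P qP *P p) *P r)
    ≡⟨ recipAt-cong (suc d + e) (expand (con a) qP p r) ⟩
  recipAt (suc d + e) (con a *P r +P qP *P (p *P r))
    ≡⟨ recipAt-+P (suc d + e) (con a *P r) (qP *P (p *P r)) ⟩
  recipAt (suc d + e) (con a *P r) +P recipAt (suc (d + e)) (qP *P (p *P r))
    ≈⟨ +P-cong (recipAt-con*P (suc d + e) a r) (recipAt-qP*P (d + e) (p *P r)) ⟩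
  con a *P recipAt (suc d + e) r +P recipAt (d + e) (p *P r)
    ≈⟨ +P-cong (*P-cong (≋-refl {con a}) (recipAt-raise (suc d) e r degr))
               (recipAt-*P d e p r (Degree≤-∷ degp) degr) ⟩
  con a *P (q^ suc d *P recipAt e r) +P recipAt d p *P recipAt e r
    ≈⟨ collect (con a) (q^ suc d) (recipAt e r) (recipAt d p) ⟩
  (recipAt d p +P con a *P q^ suc d) *P recipAt e r
    ≈⟨ *P-cong (recipAt-∷ d a p) ≋-refl ⟨
  recipAt (suc d) (a ∷ p) *P recipAt e r
    ∎
  where
  open ≋-Reasoning
  expand : ∀ a q p r → (a +P q *P p) *P r ≋ a *P r +P q *P (p *P r)
  expand = solve-∀ polyRing
  collect : ∀ a Q R P → a *P (Q *P R) +P P *P R ≋ (P +P a *P Q) *P R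
  collect = solve-∀ polyRing

-- q-rationals along the Euclidean algorithm

Frac : Set
Frac = Poly × Poly

-- For [x]_q = N/D these give [x + 1]_q, [x/(1 + x)]_q and [-1/x]_q.
plusOne overOnePlus negRecip : Frac → Frac
plusOne     (N , D) = qP *P N +P D , D
overOnePlus (N , D) = qP *P N , qP *P N +P D
negRecip    (N , D) = -P D , qP *P N

-- [a/b]_q, computed along the subtractive Euclidean algorithm; a + b is enough fuel.
qFracFuel : ℕ → ℕ → ℕ → Frac
qFracFuel zero    _       _ = 0P , 1P
qFracFuel (suc f) zero    _ = 0P , 1P
qFracFuel (suc f) (suc a) b with b ≤? suc a
... | yes _ = plusOne (qFracFuel f (suc a ∸ b) b)
... | no  _ = overOnePlus (qFracFuel f (suc a) (b ∸ suc a))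

qFrac : ℕ → ℕ → Frac
qFrac a b = qFracFuel (a + b) a b

qFracFuel-0 : ∀ f b → qFracFuel f 0 b ≡ (0P , 1P)
qFracFuel-0 zero    b = refl
qFracFuel-0 (suc f) b = refl

fuel-≥ : ∀ {a b f} → 1 ≤ b → b ≤ suc a → suc a + b ≤ suc f → (suc a ∸ b) + b ≤ f
fuel-≥ {a} {b} {f} 1≤b b≤a fuel = ℕ.≤-pred (begin-strict
  (suc a ∸ b) + b  ≡⟨ ℕ.m∸n+n≡m b≤a ⟩
  suc a            <⟨ ℕ.m<m+n (suc a) 1≤b ⟩
  suc a + b        ≤⟨ fuel ⟩
  suc f            ∎)
  where open ℕ.≤-Reasoning

fuel-< : ∀ {a b f} → suc a < b → suc a + b ≤ suc f → suc a + (b ∸ suc a) ≤ f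
fuel-< {a} {b} {f} a<b fuel = ℕ.≤-pred (begin-strict
  suc a + (b ∸ suc a)  ≡⟨ ℕ.m+[n∸m]≡n (ℕ.<⇒≤ a<b) ⟩
  b                    <⟨ ℕ.m<n+m b z<s ⟩
  suc a + b            ≤⟨ fuel ⟩
  suc f                ∎)
  where open ℕ.≤-Reasoning

qFracFuel-enough : ∀ f f′ a b → 1 ≤ b → a + b ≤ f → a + b ≤ f′ → qFracFuel f a b ≡ qFracFuel f′ a b
qFracFuel-enough f        f′       zero    b _   _ _ = trans (qFracFuel-0 f b) (sym (qFracFuel-0 f′ b))
qFracFuel-enough (suc f) (suc f′) (suc a) b 1≤b fuel fuel′ with b ≤? suc a
... | yes b≤a = cong plusOne
      (qFracFuel-enough f f′ (suc a ∸ b) b 1≤b (fuel-≥ 1≤b b≤a fuel) (fuel-≥ 1≤b b≤a fuel′))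
... | no  b≰a = cong overOnePlus
      (qFracFuel-enough f f′ (suc a) (b ∸ suc a) (ℕ.m<n⇒0<n∸m a<b) (fuel-< a<b fuel) (fuel-< a<b fuel′))
  where a<b = ℕ.≰⇒> b≰a

qFrac-0 : ∀ b → qFrac 0 b ≡ (0P , 1P)
qFrac-0 b = qFracFuel-0 b b

qFrac-≥ : ∀ a b → 1 ≤ b → b ≤ a → qFrac a b ≡ plusOne (qFrac (a ∸ b) b)
qFrac-≥ zero    b (s≤s _) ()
qFrac-≥ (suc a) b 1≤b b≤a with b ≤? suc a
... | yes _   = cong plusOne (qFracFuel-enough _ _ (suc a ∸ b) b 1≤b (fuel-≥ 1≤b b≤a ℕ.≤-refl) ℕ.≤-refl)
... | no  b≰a = ⊥-elim (b≰a b≤a)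

qFrac-< : ∀ a b → 1 ≤ a → a < b → qFrac a b ≡ overOnePlus (qFrac a (b ∸ a))
qFrac-< (suc a) b 1≤a a<b with b ≤? suc a
... | yes b≤a = ⊥-elim (ℕ.<⇒≱ a<b b≤a)
... | no  _   = cong overOnePlus
      (qFracFuel-enough _ _ (suc a) (b ∸ suc a) (ℕ.m<n⇒0<n∸m a<b) (fuel-< a<b ℕ.≤-refl) ℕ.≤-refl)

qFrac-n-n : ∀ n → 1 ≤ n → qFrac n n ≡ plusOne (0P , 1P)
qFrac-n-n n 1≤n = begin
  qFrac n n                   ≡⟨ qFrac-≥ n n 1≤n ℕ.≤-refl ⟩
  plusOne (qFrac (n ∸ n) n)   ≡⟨ cong (λ a → plusOne (qFrac a n)) (ℕ.n∸n≡0 n) ⟩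
  plusOne (qFrac 0 n)         ≡⟨ cong plusOne (qFrac-0 n) ⟩
  plusOne (0P , 1P)           ∎
  where open ≡-Reasoning

module _ (P : ℕ → ℕ → Frac → Set)
         (base : ∀ b → 1 ≤ b → P 0 b (0P , 1P))
         (step-≥ : ∀ a b → 1 ≤ b → b ≤ a → P (a ∸ b) b (qFrac (a ∸ b) b) → P a b (plusOne (qFrac (a ∸ b) b)))
         (step-< : ∀ a b → 1 ≤ a → a < b → P a (b ∸ a) (qFrac a (b ∸ a)) → P a b (overOnePlus (qFrac a (b ∸ a))))
         where

  qFrac-ind : ∀ a b → 1 ≤ b → P a b (qFrac a b)
  qFrac-ind a b = go (a + b) a b ℕ.≤-refl
    where
    go : ∀ f a b → a + b ≤ f → 1 ≤ b → P a b (qFrac a b)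
    go f       zero    b _    1≤b = subst (P 0 b) (sym (qFrac-0 b)) (base b 1≤b)
    go (suc f) (suc a) b fuel 1≤b = by-cases (b ≤? suc a)
      where
      by-cases : Dec (b ≤ suc a) → P (suc a) b (qFrac (suc a) b)
      by-cases (yes b≤a) = subst (P (suc a) b) (sym (qFrac-≥ (suc a) b 1≤b b≤a))
        (step-≥ (suc a) b 1≤b b≤a (go f (suc a ∸ b) b (fuel-≥ 1≤b b≤a fuel) 1≤b))
      by-cases (no b≰a) = subst (P (suc a) b) (sym (qFrac-< (suc a) b (s≤s z≤n) a<b))
        (step-< (suc a) b (s≤s z≤n) a<b (go f (suc a) (b ∸ suc a) (fuel-< a<b fuel) (ℕ.m<n⇒0<n∸m a<b)))
        where a<b = ℕ.≰⇒> b≰a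

coeff-qP*P+P-0 : ∀ p r → coeff (qP *P p +P r) 0 ≡ coeff r 0
coeff-qP*P+P-0 p r = begin
  coeff (qP *P p +P r) 0               ≡⟨ coeff-+P (qP *P p) r 0 ⟩
  coeff (qP *P p) 0 ℤ.+ coeff r 0      ≡⟨ cong (ℤ._+ coeff r 0) (≋⇒≈P (qP*P≋0∷ p) 0) ⟩
  + 0 ℤ.+ coeff r 0                    ≡⟨ ℤ.+-identityˡ (coeff r 0) ⟩
  coeff r 0                            ∎
  where open ≡-Reasoning

qP*P-≉0 : ∀ p → ¬ (p ≈P 0P) → ¬ (qP *P p ≈P 0P)
qP*P-≉0 p p≉0 qp≈0 = p≉0 λ k → trans (sym (≋⇒≈P (qP*P≋0∷ p) (suc k))) (qp≈0 (suc k))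

qFrac-den[0]≡1 : ∀ a b → 1 ≤ b → coeff (proj₂ (qFrac a b)) 0 ≡ + 1
qFrac-den[0]≡1 = qFrac-ind (λ _ _ x → coeff (proj₂ x) 0 ≡ + 1) (λ _ _ → refl)
  (λ _ _ _ _ D[0]≡1 → D[0]≡1)
  (λ a b _ _ D[0]≡1 → trans (coeff-qP*P+P-0 (proj₁ (qFrac a (b ∸ a))) _) D[0]≡1)

coeff-0≡1⇒≉0 : ∀ p → coeff p 0 ≡ + 1 → ¬ (p ≈P 0P)
coeff-0≡1⇒≉0 p p[0]≡1 p≈0 with trans (sym p[0]≡1) (p≈0 0)
... | ()

qFrac-num≉0 : ∀ a b → 1 ≤ b → 1 ≤ a → ¬ (proj₁ (qFrac a b) ≈P 0P)
qFrac-num≉0 = qFrac-ind (λ a _ x → 1 ≤ a → ¬ (proj₁ x ≈P 0P)) (λ _ _ ())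
  (λ a b 1≤b _ _ _ → let (N , D) = qFrac (a ∸ b) b in
     coeff-0≡1⇒≉0 (qP *P N +P D) (trans (coeff-qP*P+P-0 N D) (qFrac-den[0]≡1 (a ∸ b) b 1≤b)))
  (λ a b 1≤a _ N≉0 _ → qP*P-≉0 (proj₁ (qFrac a (b ∸ a))) (N≉0 1≤a))

-- Over ℤ[q], Bézout's identity for these fractions only holds up to a power of q.
QBézout : Frac → Set
QBézout (N , D) = Σ Poly λ U → Σ Poly λ V → Σ ℕ λ k → N *P U +P D *P V ≋ q^ k

plusOne-QBézout : ∀ x → QBézout x → QBézout (plusOne x)
plusOne-QBézout (N , D) (U , V , k , bézout) =
  U , qP *P V -P U , suc k , ≋-trans (identity qP N D U V) (*P-cong (≋-refl {qP}) bézout)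
  where
  identity : ∀ q N D U V → (q *P N +P D) *P U +P D *P (q *P V -P U) ≋ q *P (N *P U +P D *P V)
  identity = solve-∀ polyRing

overOnePlus-QBézout : ∀ x → QBézout x → QBézout (overOnePlus x)
overOnePlus-QBézout (N , D) (U , V , k , bézout) =
  U -P qP *P V , qP *P V , suc k , ≋-trans (identity qP N D U V) (*P-cong (≋-refl {qP}) bézout)
  where
  identity : ∀ q N D U V → (q *P N) *P (U -P q *P V) +P (q *P N +P D) *P (q *P V) ≋ q *P (N *P U +P D *P V)
  identity = solve-∀ polyRing

qFrac-QBézout : ∀ a b → 1 ≤ b → QBézout (qFrac a b)
qFrac-QBézout = qFrac-ind (λ _ _ → QBézout) (λ _ _ → 0P , 1P , 0 , *P-identityˡ 1P)
  (λ a b _ _ → plusOne-QBézout (qFrac (a ∸ b) b))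
  (λ a b _ _ → overOnePlus-QBézout (qFrac a (b ∸ a)))

ReversalAt : ℕ → Frac → Frac → Set
ReversalAt d (N , D) (N′ , D′) = Degree≤ d N × Degree≤ d D × N′ ≋ recipAt d D × D′ ≋ recipAt d N

recipAt-qP*P+P : ∀ d N D → Degree≤ d D → recipAt (suc d) (qP *P N +P D) ≋ qP *P recipAt d D +P recipAt d N
recipAt-qP*P+P d N D deg = begin
  recipAt (suc d) (qP *P N +P D)                   ≡⟨ recipAt-+P (suc d) (qP *P N) D ⟩
  recipAt (suc d) (qP *P N) +P recipAt (suc d) D   ≈⟨ +P-cong (recipAt-qP*P d N) (recipAt-suc d D deg) ⟩
  recipAt d N +P qP *P recipAt d D                 ≈⟨ +P-comm (recipAt d N) (qP *P recipAt d D) ⟩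
  qP *P recipAt d D +P recipAt d N                 ∎
  where open ≋-Reasoning

Degree≤-qP*P+P : ∀ {d} N D → Degree≤ d N → Degree≤ d D → Degree≤ (suc d) (qP *P N +P D)
Degree≤-qP*P+P {d} N D degN degD =
  Degree≤-+P {p = qP *P N} (Degree≤-qP*P {p = N} degN) (Degree≤-mono {p = D} (ℕ.n≤1+n d) degD)

plusOne-overOnePlus-ReversalAt : ∀ d x y → ReversalAt d x y → ReversalAt (suc d) (plusOne x) (overOnePlus y)
plusOne-overOnePlus-ReversalAt d (N , D) (N′ , D′) (degN , degD , N′≋ , D′≋) =
  Degree≤-qP*P+P N D degN degD ,
  Degree≤-mono {p = D} (ℕ.n≤1+n d) degD ,
  ≋-sym (≋-trans (recipAt-suc d D degD) (*P-cong (≋-refl {qP}) (≋-sym N′≋))) ,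
  ≋-sym (≋-trans (recipAt-qP*P+P d N D degD) (+P-cong (*P-cong (≋-refl {qP}) (≋-sym N′≋)) (≋-sym D′≋)))

overOnePlus-plusOne-ReversalAt : ∀ d x y → ReversalAt d x y → ReversalAt (suc d) (overOnePlus x) (plusOne y)
overOnePlus-plusOne-ReversalAt d (N , D) (N′ , D′) (degN , degD , N′≋ , D′≋) =
  Degree≤-qP*P {p = N} degN ,
  Degree≤-qP*P+P N D degN degD ,
  ≋-sym (≋-trans (recipAt-qP*P+P d N D degD) (+P-cong (*P-cong (≋-refl {qP}) (≋-sym N′≋)) (≋-sym D′≋))) ,
  ≋-sym (≋-trans (recipAt-qP*P d N) (≋-sym D′≋))

ReversalAt-one : ReversalAt 0 (plusOne (0P , 1P)) (plusOne (0P , 1P))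
ReversalAt-one = (λ { (suc zero) _ → refl ; (suc (suc k)) _ → refl }) , (λ { (suc k) _ → refl }) ,
  mk≋ (λ { zero → refl ; (suc zero) → refl ; (suc (suc k)) → refl }) ,
  mk≋ (λ { zero → refl ; (suc zero) → refl ; (suc (suc k)) → refl })

qFrac-ReversalAt : ∀ a b → 1 ≤ b → 1 ≤ a → ∃ λ d → ReversalAt d (qFrac a b) (qFrac b a)
qFrac-ReversalAt = qFrac-ind (λ a b x → 1 ≤ a → ∃ λ d → ReversalAt d x (qFrac b a)) (λ _ _ ())
  (λ a b 1≤b b≤a IH _ → step-≥ a b 1≤b IH (ℕ.m≤n⇒m<n∨m≡n b≤a))
  (λ a b 1≤a a<b IH _ → let d , rev = IH 1≤a in
    suc d , subst (ReversalAt (suc d) (overOnePlus (qFrac a (b ∸ a)))) (sym (qFrac-≥ b a 1≤a (ℕ.<⇒≤ a<b)))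
                  (overOnePlus-plusOne-ReversalAt d (qFrac a (b ∸ a)) (qFrac (b ∸ a) a) rev))
  where
  step-≥ : ∀ a b → 1 ≤ b → (1 ≤ a ∸ b → ∃ λ d → ReversalAt d (qFrac (a ∸ b) b) (qFrac b (a ∸ b))) →
           b < a ⊎ b ≡ a → ∃ λ d → ReversalAt d (plusOne (qFrac (a ∸ b) b)) (qFrac b a)
  step-≥ a b 1≤b IH (inj₁ b<a) = let d , rev = IH (ℕ.m<n⇒0<n∸m b<a) in
    suc d , subst (ReversalAt (suc d) (plusOne (qFrac (a ∸ b) b))) (sym (qFrac-< b a 1≤b b<a))
                  (plusOne-overOnePlus-ReversalAt d (qFrac (a ∸ b) b) (qFrac b (a ∸ b)) rev)
  step-≥ b b 1≤b IH (inj₂ refl) =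
    0 , subst₂ (ReversalAt 0) (cong plusOne (sym qFrac[0,b])) (sym (qFrac-n-n b 1≤b)) ReversalAt-one
    where
    qFrac[0,b] : qFrac (b ∸ b) b ≡ (0P , 1P)
    qFrac[0,b] = trans (cong (λ a → qFrac a b) (ℕ.n∸n≡0 b)) (qFrac-0 b)

coeff-*P-0-unit : ∀ D W → coeff D 0 ≡ + 1 → coeff (D *P W) 0 ≡ coeff W 0
coeff-*P-0-unit D W D[0]≡1 =
  trans (coeff-*P-zero D W) (trans (cong (ℤ._* coeff W 0) D[0]≡1) (ℤ.*-identityˡ (coeff W 0)))

coeff-qP*P*P-0 : ∀ p X → coeff (qP *P p *P X) 0 ≡ + 0
coeff-qP*P*P-0 p X =
  trans (coeff-*P-zero (qP *P p) X) (trans (cong (ℤ._* coeff X 0) (≋⇒≈P (qP*P≋0∷ p) 0)) (ℤ.*-zeroˡ (coeff X 0)))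

coeff-qNN+DD-0 : ∀ N D → coeff D 0 ≡ + 1 → coeff (qP *P N *P N +P D *P D) 0 ≡ + 1
coeff-qNN+DD-0 N D D[0]≡1 = begin
  coeff (qP *P N *P N +P D *P D) 0               ≡⟨ coeff-+P (qP *P N *P N) (D *P D) 0 ⟩
  coeff (qP *P N *P N) 0 ℤ.+ coeff (D *P D) 0    ≡⟨ cong₂ ℤ._+_ (coeff-qP*P*P-0 N N) (coeff-*P-0-unit D D D[0]≡1) ⟩
  + 0 ℤ.+ coeff D 0                              ≡⟨ ℤ.+-identityˡ (coeff D 0) ⟩
  coeff D 0                                      ≡⟨ D[0]≡1 ⟩
  + 1                                            ∎
  where open ≡-Reasoning

recip-qNN+DD : ∀ d N D N′ D′ → ReversalAt d (N , D) (N′ , D′) → coeff D′ 0 ≡ + 1 →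
               recip (qP *P N *P N +P D *P D) ≋ qP *P N′ *P N′ +P D′ *P D′
recip-qNN+DD d N D N′ D′ (degN , degD , N′≋ , D′≋) D′[0]≡1 =
  ≋-trans (≡⇒≋ (recip≡recipAt (suc d + d) C degC top≢0)) recipAt-C
  where
  open ≋-Reasoning
  C = qP *P N *P N +P D *P D
  degC : Degree≤ (suc d + d) C
  degC = Degree≤-+P {p = qP *P N *P N}
    (Degree≤-*P (suc d) (qP *P N) (Degree≤-qP*P {p = N} degN) degN)
    (Degree≤-mono {p = D *P D} (ℕ.n≤1+n (d + d)) (Degree≤-*P d D degD degD))
  recipAt-C : recipAt (suc d + d) C ≋ qP *P N′ *P N′ +P D′ *P D′
  recipAt-C = begin
    recipAt (suc d + d) C
      ≡⟨ recipAt-+P (suc d + d) (qP *P N *P N) (D *P D) ⟩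
    recipAt (suc d + d) (qP *P N *P N) +P recipAt (suc (d + d)) (D *P D)
      ≈⟨ +P-cong (recipAt-*P (suc d) d (qP *P N) N (Degree≤-qP*P {p = N} degN) degN)
                 (recipAt-suc (d + d) (D *P D) (Degree≤-*P d D degD degD)) ⟩
    recipAt (suc d) (qP *P N) *P recipAt d N +P qP *P recipAt (d + d) (D *P D)
      ≈⟨ +P-cong (*P-cong (recipAt-qP*P d N) (≋-refl {recipAt d N}))
                 (*P-cong (≋-refl {qP}) (recipAt-*P d d D D degD degD)) ⟩
    recipAt d N *P recipAt d N +P qP *P (recipAt d D *P recipAt d D)
      ≈⟨ +P-cong (*P-cong (≋-sym D′≋) (≋-sym D′≋)) (*P-cong (≋-refl {qP}) (*P-cong (≋-sym N′≋) (≋-sym N′≋))) ⟩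
    D′ *P D′ +P qP *P (N′ *P N′)
      ≈⟨ reorder qP N′ D′ ⟩
    qP *P N′ *P N′ +P D′ *P D′
      ∎
    where
    reorder : ∀ q N D → D *P D +P q *P (N *P N) ≋ q *P N *P N +P D *P D
    reorder = solve-∀ polyRing
  top≢0 : coeff C (suc d + d) ≢ + 0
  top≢0 C[top]≡0 with trans (sym (coeff-qNN+DD-0 N′ D′ D′[0]≡1)) (trans (sym (≋⇒≈P recipAt-C 0)) C[top]≡0)
  ... | ()

-- Fractions and the defining rules of [x]_q

noZeroDivisors : ∀ p r → ¬ (p ≈P 0P) → p *P r ≋ 0P → r ≋ 0P
noZeroDivisors []      r p≉0 _ = ⊥-elim (p≉0 λ _ → refl)
noZeroDivisors (a ∷ p) r p≉0 pr≋0 with a ℤ.≟ + 0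
... | yes refl = noZeroDivisors p r (λ p≈0 → p≉0 λ { zero → refl ; (suc k) → p≈0 k })
                   (mk≋ (≋⇒≈P (≋-trans (≋-sym (0∷-*P p r)) pr≋0) ∘ suc))
... | no  a≢0  = go r pr≋0
  where
  go : ∀ r → (a ∷ p) *P r ≋ 0P → r ≋ 0P
  go []      _     = ≋-refl
  go (b ∷ r) pr≋0 with ℤ.i*j≡0⇒i≡0∨j≡0 a (trans (sym (coeff-∷-*P-zero a p (b ∷ r))) (≋⇒≈P pr≋0 0))
  ... | inj₁ a≡0 = ⊥-elim (a≢0 a≡0)
  ... | inj₂ refl = mk≋ λ { zero → refl ; (suc k) → ≋⇒≈P (go r (mk≋ (≋⇒≈P shifted ∘ suc))) k }
    where
    shifted : + 0 ∷ (a ∷ p) *P r ≋ 0P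
    shifted = begin
      + 0 ∷ (a ∷ p) *P r     ≈⟨ ∷-cong refl (*P-comm (a ∷ p) r) ⟩
      + 0 ∷ r *P (a ∷ p)     ≈⟨ 0∷-*P r (a ∷ p) ⟨
      (+ 0 ∷ r) *P (a ∷ p)   ≈⟨ *P-comm (+ 0 ∷ r) (a ∷ p) ⟩
      (a ∷ p) *P (+ 0 ∷ r)   ≈⟨ pr≋0 ⟩
      0P                     ∎
      where open ≋-Reasoning

*P-cancelˡ : ∀ p {r s} → ¬ (p ≈P 0P) → p *P r ≋ p *P s → r ≋ s
*P-cancelˡ p {r} {s} p≉0 pr≋ps = begin
  r                 ≈⟨ split r s ⟩
  (r -P s) +P s     ≈⟨ +P-cong r-s≋0 (≋-refl {s}) ⟩
  s                 ∎
  where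
  open ≋-Reasoning
  split : ∀ r s → r ≋ (r -P s) +P s
  split = solve-∀ polyRing
  factor : ∀ p r s → p *P (r -P s) ≋ p *P r -P p *P s
  factor = solve-∀ polyRing
  r-s≋0 : r -P s ≋ 0P
  r-s≋0 = noZeroDivisors p (r -P s) p≉0
    (≋-trans (factor p r s) (≋-trans (+P-cong pr≋ps (≋-refl { -P (p *P s)})) (-P-inverseʳ (p *P s))))

infix 4 _≃F_ _≋F_

_≃F_ : Frac → Frac → Set
(N , D) ≃F (N′ , D′) = N *P D′ ≋ N′ *P D

_≋F_ : Frac → Frac → Set
(N , D) ≋F (N′ , D′) = N ≋ N′ × D ≋ D′

≃F-refl : ∀ x → x ≃F x
≃F-refl (N , D) = ≋-refl

≡⇒≃F : ∀ {x y} → x ≡ y → x ≃F y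
≡⇒≃F {x} refl = ≃F-refl x

≃F-trans : ∀ x y z → ¬ (proj₂ y ≈P 0P) → x ≃F y → y ≃F z → x ≃F z
≃F-trans (a , b) (c , d) (e , f) d≉0 ad≋cb cf≋ed = *P-cancelˡ d d≉0 (begin
  d *P (a *P f)     ≈⟨ swap₁ a d f ⟩
  (a *P d) *P f     ≈⟨ *P-cong ad≋cb (≋-refl {f}) ⟩
  (c *P b) *P f     ≈⟨ swap₂ c b f ⟩
  b *P (c *P f)     ≈⟨ *P-cong (≋-refl {b}) cf≋ed ⟩
  b *P (e *P d)     ≈⟨ swap₃ b e d ⟩
  d *P (e *P b)     ∎)
  where
  open ≋-Reasoning
  swap₁ : ∀ a d f → d *P (a *P f) ≋ (a *P d) *P f
  swap₁ = solve-∀ polyRing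
  swap₂ : ∀ c b f → (c *P b) *P f ≋ b *P (c *P f)
  swap₂ = solve-∀ polyRing
  swap₃ : ∀ b e d → b *P (e *P d) ≋ d *P (e *P b)
  swap₃ = solve-∀ polyRing

plusOne-cong : ∀ x y → x ≃F y → plusOne x ≃F plusOne y
plusOne-cong (N , D) (N′ , D′) ND′≋N′D = begin
  (qP *P N +P D) *P D′          ≈⟨ expand qP N D D′ ⟩
  qP *P (N *P D′) +P D *P D′    ≈⟨ +P-cong (*P-cong (≋-refl {qP}) ND′≋N′D) (*P-comm D D′) ⟩
  qP *P (N′ *P D) +P D′ *P D    ≈⟨ expand qP N′ D′ D ⟨
  (qP *P N′ +P D′) *P D         ∎
  where
  open ≋-Reasoning
  expand : ∀ q N D D′ → (q *P N +P D) *P D′ ≋ q *P (N *P D′) +P D *P D′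
  expand = solve-∀ polyRing

negRecip-cong : ∀ x y → x ≃F y → negRecip x ≃F negRecip y
negRecip-cong (N , D) (N′ , D′) ND′≋N′D = begin
  -P D *P (qP *P N′)      ≈⟨ rearrange qP N′ D ⟩
  -P (qP *P (N′ *P D))    ≈⟨ -P-cong (*P-cong (≋-refl {qP}) ND′≋N′D) ⟨
  -P (qP *P (N *P D′))    ≈⟨ rearrange qP N D′ ⟨
  -P D′ *P (qP *P N)      ∎
  where
  open ≋-Reasoning
  rearrange : ∀ q N D → -P D *P (q *P N) ≋ -P (q *P (N *P D))
  rearrange = solve-∀ polyRing

negRecip-negRecip : ∀ x → negRecip (negRecip x) ≃F x
negRecip-negRecip (N , D) = identity qP N D
  where
  identity : ∀ q N D → -P (q *P N) *P D ≋ N *P (q *P -P D)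
  identity = solve-∀ polyRing

plusOne-negRecip-plusOne : ∀ y → plusOne (negRecip (plusOne y)) ≃F overOnePlus y
plusOne-negRecip-plusOne (N , D) = identity qP N D
  where
  identity : ∀ q N D → (q *P -P D +P q *P (q *P N +P D)) *P (q *P N +P D) ≋ (q *P N) *P (q *P (q *P N +P D))
  identity = solve-∀ polyRing

plusOne-negRecip-overOnePlus : ∀ y → plusOne (negRecip (overOnePlus y)) ≃F negRecip y
plusOne-negRecip-overOnePlus (N , D) = identity qP N D
  where
  identity : ∀ q N D → (q *P -P (q *P N +P D) +P q *P (q *P N)) *P (q *P N) ≋ -P D *P (q *P (q *P N))
  identity = solve-∀ polyRing

-- For i < 0, i/n = -1/y with y = n/|i|.
qFracℤ : ℤ → ℕ → Frac
qFracℤ (+ a)    n = qFrac a n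
qFracℤ -[1+ a ] n = negRecip (qFrac n (suc a))

qFracℚ : ℚ → Frac
qFracℚ x = qFracℤ (↥ x) (↧ₙ x)

plusOne-negRecip-one : plusOne (negRecip (plusOne (0P , 1P))) ≃F (0P , 1P)
plusOne-negRecip-one =
  mk≋ λ { 0 → refl ; 1 → refl ; 2 → refl ; 3 → refl ; 4 → refl ; (suc (suc (suc (suc (suc k))))) → refl }

plusOne-negRecip-qFrac : ∀ a n → 1 ≤ n → plusOne (negRecip (qFrac n (suc a))) ≃F qFracℤ (n ℤ.⊖ suc a) n
plusOne-negRecip-qFrac a n 1≤n with ℕ.<-cmp (suc a) n
... | tri< a<n _ _ = subst₂ _≃F_ (cong (plusOne ∘ negRecip) (sym qFrac[n,a])) (sym qFracℤ[n-a,n])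
                       (plusOne-negRecip-plusOne y)
  where
  y = qFrac (n ∸ suc a) (suc a)
  qFrac[n,a] : qFrac n (suc a) ≡ plusOne y
  qFrac[n,a] = qFrac-≥ n (suc a) (s≤s z≤n) (ℕ.<⇒≤ a<n)
  qFracℤ[n-a,n] : qFracℤ (n ℤ.⊖ suc a) n ≡ overOnePlus y
  qFracℤ[n-a,n] = begin
    qFracℤ (n ℤ.⊖ suc a) n
      ≡⟨ cong (λ i → qFracℤ i n) (ℤ.⊖-≥ (ℕ.<⇒≤ a<n)) ⟩
    qFrac (n ∸ suc a) n
      ≡⟨ qFrac-< (n ∸ suc a) n (ℕ.m<n⇒0<n∸m a<n) (ℕ.∸-monoʳ-< z<s (ℕ.<⇒≤ a<n)) ⟩
    overOnePlus (qFrac (n ∸ suc a) (n ∸ (n ∸ suc a)))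
      ≡⟨ cong (λ b → overOnePlus (qFrac (n ∸ suc a) b)) (ℕ.m∸[m∸n]≡n (ℕ.<⇒≤ a<n)) ⟩
    overOnePlus y ∎
    where open ≡-Reasoning
... | tri≈ _ refl _ = subst₂ _≃F_ (cong (plusOne ∘ negRecip) (sym (qFrac-n-n n 1≤n))) (sym qFracℤ[0,n])
                        plusOne-negRecip-one
  where
  qFracℤ[0,n] : qFracℤ (n ℤ.⊖ n) n ≡ (0P , 1P)
  qFracℤ[0,n] = trans (cong (λ i → qFracℤ i n) (ℤ.n⊖n≡0 n)) (qFrac-0 n)
... | tri> _ _ n<a = subst₂ _≃F_ (cong (plusOne ∘ negRecip) (sym qFrac[n,a])) (sym qFracℤ[n-a,n])
                       (plusOne-negRecip-overOnePlus y)
  where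
  y = qFrac n (suc (a ∸ n))
  a-n : suc a ∸ n ≡ suc (a ∸ n)
  a-n = ℕ.+-∸-assoc 1 (ℕ.≤-pred n<a)
  qFrac[n,a] : qFrac n (suc a) ≡ overOnePlus y
  qFrac[n,a] = trans (qFrac-< n (suc a) 1≤n n<a) (cong (λ b → overOnePlus (qFrac n b)) a-n)
  qFracℤ[n-a,n] : qFracℤ (n ℤ.⊖ suc a) n ≡ negRecip y
  qFracℤ[n-a,n] = cong (λ i → qFracℤ i n) (trans (ℤ.⊖-< n<a) (cong (λ k → ℤ.- (+ k)) a-n))

qFracℤ-+ : ∀ i n → 1 ≤ n → plusOne (qFracℤ i n) ≃F qFracℤ (i ℤ.+ + n) n
qFracℤ-+ (+ a) n 1≤n = ≡⇒≃F (sym (begin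
  qFrac (a + n) n                 ≡⟨ qFrac-≥ (a + n) n 1≤n (ℕ.m≤n+m n a) ⟩
  plusOne (qFrac (a + n ∸ n) n)   ≡⟨ cong (λ c → plusOne (qFrac c n)) (ℕ.m+n∸n≡m a n) ⟩
  plusOne (qFrac a n)             ∎))
  where open ≡-Reasoning
qFracℤ-+ -[1+ a ] n 1≤n = plusOne-negRecip-qFrac a n 1≤n

coprime-+ℤ : ∀ i n → Coprime ℤ.∣ i ∣ n → Coprime ℤ.∣ i ℤ.+ + n ∣ n
coprime-+ℤ i n coprime {k} (k∣i+n , k∣n) =
  coprime (∣⇒∣ᵤ (∣m+n∣n⇒∣m {i = + k} {m = i} {n = + n} (∣ᵤ⇒∣ k∣i+n) (∣ᵤ⇒∣ k∣n)) , k∣n)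

+1ℚ-≡ : ∀ x y → ↥ y ≡ ↥ x ℤ.+ ↧ x → ↧ y ≡ ↧ x → x ℚ.+ 1ℚ ≡ y
+1ℚ-≡ x y ↥y ↧y = ℚ.≃⇒≡ (ℚ.*≡* (begin
  ↥ z ℤ.* ↧ y
    ≡⟨ cong (↥ z ℤ.*_) (trans ↧y (sym (ℤ.*-identityʳ (↧ x)))) ⟩
  ↥ z ℤ.* (↧ x ℤ.* + 1)
    ≡⟨ cross (↥ z) (↧ z) _ (ℚ.↥-+ x 1ℚ) (ℚ.↧-+ x 1ℚ) ⟩
  (↥ x ℤ.* + 1 ℤ.+ + 1 ℤ.* ↧ x) ℤ.* ↧ z
    ≡⟨ cong (ℤ._* ↧ z) (cong₂ ℤ._+_ (ℤ.*-identityʳ (↥ x)) (ℤ.*-identityˡ (↧ x))) ⟩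
  (↥ x ℤ.+ ↧ x) ℤ.* ↧ z
    ≡⟨ cong (ℤ._* ↧ z) ↥y ⟨
  ↥ y ℤ.* ↧ z
    ∎))
  where
  open ≡-Reasoning
  z = x ℚ.+ 1ℚ
  -- ↥-+ and ↧-+ only determine ↥ z and ↧ z up to the common factor g
  cross : ∀ a b g {u v} → a ℤ.* g ≡ u → b ℤ.* g ≡ v → a ℤ.* v ≡ u ℤ.* b
  cross a b g refl refl = solveℤ a b g
    where
    solveℤ : ∀ a b g → a ℤ.* (b ℤ.* g) ≡ (a ℤ.* g) ℤ.* b
    solveℤ = solveℤ-∀

qFracℚ-+1 : ∀ x → plusOne (qFracℚ x) ≃F qFracℚ (x ℚ.+ 1ℚ)
qFracℚ-+1 (mkℚ i d c) = subst (plusOne (qFracℤ i (suc d)) ≃F_) (cong qFracℚ (sym x+1≡))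
                            (qFracℤ-+ i (suc d) (s≤s z≤n))
  where
  x+1≡ : mkℚ i d c ℚ.+ 1ℚ ≡ mkℚ (i ℤ.+ + suc d) d (coprime-+ℤ i (suc d) c)
  x+1≡ = +1ℚ-≡ (mkℚ i d c) _ refl refl

qFracℚ-negRecip : ∀ x .{{_ : ℚ.NonZero x}} → negRecip (qFracℚ x) ≃F qFracℚ (ℚ.- (ℚ.1/ x))
qFracℚ-negRecip (mkℚ (+ zero)   d c) {{x≢0}} = ⊥-elim-irr (ℕ.NonZero.nonZero x≢0)
qFracℚ-negRecip (mkℚ ℤ.+[1+ a ] d c)       = ≃F-refl (negRecip (qFrac (suc a) (suc d)))
qFracℚ-negRecip (mkℚ -[1+ a ]   d c)       = negRecip-negRecip (qFrac (suc d) (suc a))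

-P-≉0 : ∀ p → ¬ (p ≈P 0P) → ¬ (-P p ≈P 0P)
-P-≉0 p p≉0 -p≈0 = p≉0 λ k →
  trans (sym (ℤ.neg-involutive (coeff p k))) (cong ℤ.-_ (trans (sym (coeff--P p k)) (-p≈0 k)))

qFracℚ-den≉0 : ∀ x → ¬ (proj₂ (qFracℚ x) ≈P 0P)
qFracℚ-den≉0 (mkℚ (+ a)    d _) =
  coeff-0≡1⇒≉0 (proj₂ (qFrac a (suc d))) (qFrac-den[0]≡1 a (suc d) (s≤s z≤n))
qFracℚ-den≉0 (mkℚ -[1+ a ] d _) =
  qP*P-≉0 (proj₁ (qFrac (suc d) (suc a))) (qFrac-num≉0 (suc d) (suc a) (s≤s z≤n) (s≤s z≤n))

qFracℚ-num≉0 : ∀ x .{{_ : ℚ.NonZero x}} → ¬ (proj₁ (qFracℚ x) ≈P 0P)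
qFracℚ-num≉0 (mkℚ (+ zero)   d _) {{x≢0}} = ⊥-elim-irr (ℕ.NonZero.nonZero x≢0)
qFracℚ-num≉0 (mkℚ ℤ.+[1+ a ] d _)       = qFrac-num≉0 (suc a) (suc d) (s≤s z≤n) (s≤s z≤n)
qFracℚ-num≉0 (mkℚ -[1+ a ]   d _)       = -P-≉0 D (coeff-0≡1⇒≉0 D (qFrac-den[0]≡1 (suc d) (suc a) (s≤s z≤n)))
  where D = proj₂ (qFrac (suc d) (suc a))

Rep⇒≃F : ∀ {x N D} → Rep x N D → ¬ (D ≈P 0P) × (N , D) ≃F qFracℚ x
Rep⇒≃F rep0 = coeff-0≡1⇒≉0 1P refl , ≃F-refl (0P , 1P)
Rep⇒≃F (repSuc {x} {N} {D} r) with Rep⇒≃F r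
... | D≉0 , ≃x = D≉0 , ≃F-trans (plusOne (N , D)) (plusOne (qFracℚ x)) (qFracℚ (x ℚ.+ 1ℚ))
                          (qFracℚ-den≉0 x) (plusOne-cong (N , D) (qFracℚ x) ≃x) (qFracℚ-+1 x)
Rep⇒≃F (repInv {x} {N} {D} r N≉0) with Rep⇒≃F r
... | _ , ≃x = qP*P-≉0 N N≉0 , ≃F-trans (negRecip (N , D)) (negRecip (qFracℚ x)) (qFracℚ (ℚ.- (ℚ.1/ x)))
                                  (qP*P-≉0 (proj₁ (qFracℚ x)) (qFracℚ-num≉0 x))
                                  (negRecip-cong (N , D) (qFracℚ x) ≃x) (qFracℚ-negRecip x)
Rep⇒≃F (repEq {x} {N} {D} {N′} {D′} r ND′≈N′D D′≉0) with Rep⇒≃F r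
... | D≉0 , ≃x = D′≉0 , ≃F-trans (N′ , D′) (N , D) (qFracℚ x) D≉0 (≋-sym (mk≋ ND′≈N′D)) ≃x

-- Uniqueness of the reduced fraction

qP≉0P : ¬ (qP ≈P 0P)
qP≉0P qP≈0 with qP≈0 1
... | ()

q^-≉0 : ∀ k → ¬ (q^ k ≈P 0P)
q^-≉0 zero    = coeff-0≡1⇒≉0 1P refl
q^-≉0 (suc k) = qP*P-≉0 (q^ k) (q^-≉0 k)

coeff-0≡0⇒≋qP*P-drop : ∀ W → coeff W 0 ≡ + 0 → W ≋ qP *P drop 1 W
coeff-0≡0⇒≋qP*P-drop []      _      = ≋-sym (≋-trans (qP*P≋0∷ []) (mk≋ λ { zero → refl ; (suc k) → refl }))
coeff-0≡0⇒≋qP*P-drop (a ∷ W) a≡0    = ≋-trans (∷-cong a≡0 ≋-refl) (≋-sym (qP*P≋0∷ W))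

q^∣*P⇒q^∣ : ∀ k D W → coeff D 0 ≡ + 1 → (q^ k) ∣P (D *P W) → (q^ k) ∣P W
q^∣*P⇒q^∣ zero    D W _      _                 = W , ≋⇒≈P (*P-identityˡ W)
q^∣*P⇒q^∣ (suc k) D W D[0]≡1 (X , q^k+1X≈DW) = r , ≋⇒≈P (begin
  q^ suc k *P r          ≈⟨ *P-assoc qP (q^ k) r ⟩
  qP *P (q^ k *P r)      ≈⟨ *P-cong (≋-refl {qP}) (mk≋ q^kr≈W′) ⟩
  qP *P W′               ≈⟨ coeff-0≡0⇒≋qP*P-drop W W[0]≡0 ⟨
  W                      ∎)
  where
  open ≋-Reasoning
  W′ = drop 1 W
  W[0]≡0 : coeff W 0 ≡ + 0
  W[0]≡0 = trans (sym (coeff-*P-0-unit D W D[0]≡1)) (trans (sym (q^k+1X≈DW 0)) (coeff-qP*P*P-0 (q^ k) X))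
  q^kX≋DW′ : q^ k *P X ≋ D *P W′
  q^kX≋DW′ = *P-cancelˡ qP qP≉0P (begin
    qP *P (q^ k *P X)     ≈⟨ *P-assoc qP (q^ k) X ⟨
    q^ suc k *P X         ≈⟨ mk≋ q^k+1X≈DW ⟩
    D *P W                ≈⟨ *P-cong (≋-refl {D}) (coeff-0≡0⇒≋qP*P-drop W W[0]≡0) ⟩
    D *P (qP *P W′)       ≈⟨ swap D qP W′ ⟩
    qP *P (D *P W′)       ∎)
    where
    swap : ∀ D q W → D *P (q *P W) ≋ q *P (D *P W)
    swap = solve-∀ polyRing
  IH = q^∣*P⇒q^∣ k D W′ D[0]≡1 (X , ≋⇒≈P q^kX≋DW′)
  r = proj₁ IH
  q^kr≈W′ = proj₂ IH

scale-by-bézout : ∀ N D N₀ D₀ U V k → (N , D) ≃F (N₀ , D₀) → N₀ *P U +P D₀ *P V ≋ q^ k →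
                  q^ k *P N ≋ N₀ *P (N *P U +P D *P V) × q^ k *P D ≋ D₀ *P (N *P U +P D *P V)
scale-by-bézout N D N₀ D₀ U V k ND₀≋N₀D bézout = scaleN , scaleD
  where
  open ≋-Reasoning
  scaleN : q^ k *P N ≋ N₀ *P (N *P U +P D *P V)
  scaleN = begin
    q^ k *P N                          ≈⟨ *P-cong (≋-sym bézout) (≋-refl {N}) ⟩
    (N₀ *P U +P D₀ *P V) *P N          ≈⟨ regroup N D N₀ D₀ U V ⟩
    N₀ *P (N *P U) +P (N *P D₀) *P V   ≈⟨ +P-cong (≋-refl {N₀ *P (N *P U)}) (*P-cong ND₀≋N₀D (≋-refl {V})) ⟩
    N₀ *P (N *P U) +P (N₀ *P D) *P V   ≈⟨ factor N D N₀ U V ⟩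
    N₀ *P (N *P U +P D *P V)           ∎
    where
    regroup : ∀ N D N₀ D₀ U V → (N₀ *P U +P D₀ *P V) *P N ≋ N₀ *P (N *P U) +P (N *P D₀) *P V
    regroup = solve-∀ polyRing
    factor : ∀ N D N₀ U V → N₀ *P (N *P U) +P (N₀ *P D) *P V ≋ N₀ *P (N *P U +P D *P V)
    factor = solve-∀ polyRing
  scaleD : q^ k *P D ≋ D₀ *P (N *P U +P D *P V)
  scaleD = begin
    q^ k *P D                          ≈⟨ *P-cong (≋-sym bézout) (≋-refl {D}) ⟩
    (N₀ *P U +P D₀ *P V) *P D          ≈⟨ regroup N D N₀ D₀ U V ⟩
    (N₀ *P D) *P U +P D₀ *P (D *P V)   ≈⟨ +P-cong (*P-cong (≋-sym ND₀≋N₀D) (≋-refl {U})) (≋-refl {D₀ *P (D *P V)}) ⟩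
    (N *P D₀) *P U +P D₀ *P (D *P V)   ≈⟨ factor N D D₀ U V ⟩
    D₀ *P (N *P U +P D *P V)           ∎
    where
    regroup : ∀ N D N₀ D₀ U V → (N₀ *P U +P D₀ *P V) *P D ≋ (N₀ *P D) *P U +P D₀ *P (D *P V)
    regroup = solve-∀ polyRing
    factor : ∀ N D D₀ U V → (N *P D₀) *P U +P D₀ *P (D *P V) ≋ D₀ *P (N *P U +P D *P V)
    factor = solve-∀ polyRing

common-factor : ∀ k N D N₀ D₀ W → coeff D₀ 0 ≡ + 1 → q^ k *P N ≋ N₀ *P W → q^ k *P D ≋ D₀ *P W →
                Σ Poly λ r → N ≋ N₀ *P r × D ≋ D₀ *P r
common-factor k N D N₀ D₀ W D₀[0]≡1 q^kN≋N₀W q^kD≋D₀W = r , cancel-q^k N N₀ q^kN≋N₀W , cancel-q^k D D₀ q^kD≋D₀W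
  where
  q^k∣W = q^∣*P⇒q^∣ k D₀ W D₀[0]≡1 (D , ≋⇒≈P q^kD≋D₀W)
  r = proj₁ q^k∣W
  cancel-q^k : ∀ P P₀ → q^ k *P P ≋ P₀ *P W → P ≋ P₀ *P r
  cancel-q^k P P₀ q^kP≋P₀W = *P-cancelˡ (q^ k) (q^-≉0 k) (begin
    q^ k *P P            ≈⟨ q^kP≋P₀W ⟩
    P₀ *P W              ≈⟨ *P-cong (≋-refl {P₀}) (≋-sym (mk≋ (proj₂ q^k∣W))) ⟩
    P₀ *P (q^ k *P r)    ≈⟨ swap P₀ (q^ k) r ⟩
    q^ k *P (P₀ *P r)    ∎)
    where
    open ≋-Reasoning
    swap : ∀ P Q R → P *P (Q *P R) ≋ Q *P (P *P R)
    swap = solve-∀ polyRing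

coprime-unique : ∀ N D N₀ D₀ → (N , D) ≃F (N₀ , D₀) → CoprimeP N D → coeff D 0 ≡ + 1 → coeff D₀ 0 ≡ + 1 →
                 QBézout (N₀ , D₀) → (N , D) ≋F (N₀ , D₀)
coprime-unique N D N₀ D₀ ND₀≋N₀D coprime D[0]≡1 D₀[0]≡1 (U , V , k , bézout) = unit⇒≋F (coprime r r∣N r∣D)
  where
  W = N *P U +P D *P V
  scaled = scale-by-bézout N D N₀ D₀ U V k ND₀≋N₀D bézout
  factored : Σ Poly λ r → N ≋ N₀ *P r × D ≋ D₀ *P r
  factored = common-factor k N D N₀ D₀ W D₀[0]≡1 (proj₁ scaled) (proj₂ scaled)
  r : Poly
  r = proj₁ factored
  N≋N₀r : N ≋ N₀ *P r
  N≋N₀r = proj₁ (proj₂ factored)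
  D≋D₀r : D ≋ D₀ *P r
  D≋D₀r = proj₂ (proj₂ factored)
  r∣N : r ∣P N
  r∣N = N₀ , ≋⇒≈P (≋-trans (*P-comm r N₀) (≋-sym N≋N₀r))
  r∣D : r ∣P D
  r∣D = D₀ , ≋⇒≈P (≋-trans (*P-comm r D₀) (≋-sym D≋D₀r))
  unit⇒≋F : IsUnitP r → (N , D) ≋F (N₀ , D₀)
  unit⇒≋F (inj₁ r≈1) = ≋-trans N≋N₀r (≋-trans (*P-cong (≋-refl {N₀}) (mk≋ r≈1)) (*P-identityʳ N₀)) ,
                       ≋-trans D≋D₀r (≋-trans (*P-cong (≋-refl {D₀}) (mk≋ r≈1)) (*P-identityʳ D₀))
  unit⇒≋F (inj₂ r≈-1) =
    ⊥-elim (1≢-1 (trans (sym D[0]≡1) (trans (≋⇒≈P D≋D₀r 0) (trans (coeff-*P-0-unit D₀ r D₀[0]≡1) (r≈-1 0)))))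
    where
    1≢-1 : + 1 ≢ -[1+ 0 ]
    1≢-1 ()

IsND⇒≋F-qFrac : ∀ a b (1≤b : 1 ≤ b) → Coprime a b → ∀ {N D} →
                IsND ((+ a / b) {{>-nonZero 1≤b}}) N D → (N , D) ≋F qFrac a b
IsND⇒≋F-qFrac a (suc b) _ coprime-ab {N} {D} (rep , coprime-ND , D[0]≡1) =
  coprime-unique N D (proj₁ (qFrac a (suc b))) (proj₂ (qFrac a (suc b)))
    (subst ((N , D) ≃F_) (cong qFracℚ (ℚ.normalize-coprime coprime-ab)) (proj₂ (Rep⇒≃F rep)))
    coprime-ND D[0]≡1 (qFrac-den[0]≡1 a (suc b) (s≤s z≤n)) (qFrac-QBézout a (suc b) (s≤s z≤n))

ReversalAt-cong : ∀ d {x x₀ y y₀} → x ≋F x₀ → y ≋F y₀ → ReversalAt d x₀ y₀ → ReversalAt d x y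
ReversalAt-cong d {N , D} {N₀ , D₀} {N′ , D′} {N₀′ , D₀′} (N≋ , D≋) (N′≋ , D′≋) (degN₀ , degD₀ , N₀′≋ , D₀′≋) =
  Degree≤-cong (≋-sym N≋) degN₀ ,
  Degree≤-cong (≋-sym D≋) degD₀ ,
  ≋-trans N′≋ (≋-trans N₀′≋ (≡⇒≋ (recipAt-cong d (≋-sym D≋)))) ,
  ≋-trans D′≋ (≋-trans D₀′≋ (≡⇒≋ (recipAt-cong d (≋-sym N≋))))

brahmagupta : ∀ q N D N′ D′ →
  (q *P N *P N′ +P D *P D′) *P (q *P N *P N′ +P D *P D′) +P q *P (N *P D′ -P D *P N′) *P (N *P D′ -P D *P N′)
  ≋ (q *P N *P N +P D *P D) *P (q *P N′ *P N′ +P D′ *P D′)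
brahmagupta = solve-∀ polyRing

theorem2 : (m n : ℕ) → (n≥1 : 1 ≤ n) → (n<m : n < m) → Coprime m n →
    ∀ Nmn Dmn Nnm Dnm →
    IsND ((+ m / n) {{>-nonZero n≥1}}) Nmn Dmn →
    IsND ((+ n / m) {{>-nonZero (≤-trans n≥1 (<⇒≤ n<m))}}) Nnm Dnm →
    let A = qP *P Nmn *P Nnm +P Dmn *P Dnm
        B = Nmn *P Dnm -P Dmn *P Nnm
        C = qP *P Nmn *P Nmn +P Dmn *P Dmn
    in A *P A +P qP *P B *P B ≈P C *P recip C
theorem2 m n n≥1 n<m coprime Nmn Dmn Nnm Dnm ndₘₙ ndₙₘ = ≋⇒≈P (begin
  A *P A +P qP *P B *P B     ≈⟨ brahmagupta qP Nmn Dmn Nnm Dnm ⟩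
  C *P C′                    ≈⟨ *P-cong (≋-refl {C}) (≋-sym recip-C) ⟩
  C *P recip C               ∎)
  where
  open ≋-Reasoning
  A = qP *P Nmn *P Nnm +P Dmn *P Dnm
  B = Nmn *P Dnm -P Dmn *P Nnm
  C = qP *P Nmn *P Nmn +P Dmn *P Dmn
  C′ = qP *P Nnm *P Nnm +P Dnm *P Dnm
  m≥1 = ≤-trans n≥1 (<⇒≤ n<m)
  reversal = qFrac-ReversalAt m n n≥1 m≥1
  recip-C : recip C ≋ C′
  recip-C = recip-qNN+DD (proj₁ reversal) Nmn Dmn Nnm Dnm
    (ReversalAt-cong (proj₁ reversal) (IsND⇒≋F-qFrac m n n≥1 coprime ndₘₙ)
                     (IsND⇒≋F-qFrac n m m≥1 (Coprimality.sym coprime) ndₙₘ) (proj₂ reversal))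
    (proj₂ (proj₂ ndₙₘ))
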